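{- Let $\varepsilon > 0$ and let $q$ be a prime, sufficiently large with respect to $1/\varepsilon$. Let $a$ be an integer coprime to $q$, let $\kappa \in \{ -1,+1\}$, and let $N \geq q^{2+\varepsilon}$. Suppose that $\lambda(n) = \kappa$ for every positive integer $n \leq N$ with $n \equiv a \pmod{q}$. Then $\lambda(n+q) = \lambda(n)$ for all positive integers $n \leq N/q - q$ with $(n,q)=1$, and $$\#\{1 \leq n < q : (n,q)=1,\ \lambda(n) = -1\} = \frac{\varphi(q)}{2} = \#\{1 \leq n < q : (n,q)=1,\ \lambda(n) = 1\}.$$
   Context: $\lambda$ denotes the Liouville function, $\lambda(n) = (-1)^{\Omega(n)}$ with $\Omega(n)$ the number of prime factors of $n$ counted with multiplicity. $\varphi$ is Euler's totient function. -}

module Defs where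

open import Data.Nat using (ℕ; zero; suc; _+_; _*_; _≤?_)
open import Data.Nat.Divisibility using (_∣?_; divides)
open import Data.Nat.Coprimality using (Coprime; coprime?)
open import Data.Integer using (ℤ; +_; -_; _^_)
open import Data.List using (List; filter; length; upTo)
open import Data.Product using (_×_)
open import Relation.Nullary using (yes; no; _×-dec_)
open import Relation.Binary.PropositionalEquality using (_≡_)
import Data.Integer.Properties as ℤP

Ωf : ℕ → ℕ → ℕ → ℕ
Ωf zero d n = 0
Ωf (suc f) d n with n ≤? 1
... | yes _ = 0
... | no _ with d ∣? n
...   | yes (divides k _) = suc (Ωf f d k)
...   | no _ = Ωf f (suc d) n

-- Ω(n): number of prime factors of n counted with multiplicity (fuel n + n
-- suffices: at most n increments of d and at most n divisions).
Ω : ℕ → ℕ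
Ω n = Ωf (n + n) 2 n

liouville : ℕ → ℤ
liouville n = (- (+ 1)) ^ Ω n

totient : ℕ → ℕ
totient n = length (filter (λ m → (1 ≤? m) ×-dec coprime? m n) (upTo (suc n)))

countλ : ℕ → ℤ → ℕ
countλ q s = length (filter (λ n → ((1 ≤? n) ×-dec coprime? n q) ×-dec (liouville n ℤP.≟ s)) (upTo q))

-- Given n coprime to q, pick 1 ≤ m < q with m n ≡ a (mod q). Then m n and m (n + q)
-- are both ≡ a (mod q) and at most N, so complete multiplicativity gives
-- λ(m) λ(n) = κ = λ(m) λ(n + q), hence λ(n + q) = λ(n). For the count, q odd makes
-- x ↦ 2x mod q injective, and for 1 ≤ x < q it changes the sign of λ: either 2x < q,
-- or λ(2x − q) = λ(2x) by periodicity, which applies as N ≥ 2q². So doubling maps the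
-- residues with λ = s injectively into those with λ = −s, and the two classes have
-- equal size. λ is completely multiplicative because Ω(n) is the length of the prime
-- factorisation found by trial division, which is unique up to permutation.

module Submission where

module ListCounting where

  open import Data.Nat.Base using (ℕ; suc; _+_; _≤_)
  open import Data.Nat.Properties using (+-suc)
  open import Data.Fin.Base using (Fin; zero; suc)
  open import Data.Fin.Properties using (injective⇒≤)
  open import Data.List.Base using (List; []; _∷_; length; lookup; filter; upTo; [_]; _++_)
  open import Data.List.Properties using (upTo-∷ʳ; filter-++; filter-reject; ++-identityʳ)
  open import Data.List.Membership.Propositional using (_∈_)
  open import Data.List.Membership.Propositional.Properties using (∈-lookup)
  open import Data.List.Membership.Setoid.Properties using (index-injective)
  import Data.List.Relation.Unary.All as All
  open import Data.List.Relation.Unary.Any using (index)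
  open import Data.List.Relation.Unary.AllPairs using (_∷_)
  open import Data.List.Relation.Unary.Unique.Propositional using (Unique)
  open import Data.Sum.Base using (_⊎_; inj₁; inj₂)
  open import Function.Definitions using (Injective)
  open import Level using (Level)
  open import Relation.Nullary.Decidable.Core using (yes; no; _×-dec_)
  open import Relation.Nullary.Negation.Core using (¬_; contradiction)
  open import Relation.Unary using (Pred; Decidable)
  open import Data.Empty using (⊥)
  open import Relation.Binary.PropositionalEquality hiding ([_])

  private
    variable
      a b p ℓ : Level
      A : Set a
      B : Set b

  Unique⇒lookup-injective : ∀ {xs : List A} → Unique xs → Injective _≡_ _≡_ (lookup xs)
  Unique⇒lookup-injective {xs = _ ∷ _} _ {zero} {zero} _ = refl
  Unique⇒lookup-injective (x≢xs ∷ _) {zero} {suc j} eq = contradiction eq (All.lookup x≢xs (∈-lookup j))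
  Unique⇒lookup-injective (x≢xs ∷ _) {suc i} {zero} eq = contradiction (sym eq) (All.lookup x≢xs (∈-lookup i))
  Unique⇒lookup-injective (_ ∷ xs!) {suc i} {suc j} eq = cong suc (Unique⇒lookup-injective xs! eq)

  length-≤-of-injection : ∀ {xs : List A} {ys : List B} (f : A → B) → Injective _≡_ _≡_ f →
                          Unique xs → (∀ {x} → x ∈ xs → f x ∈ ys) → length xs ≤ length ys
  length-≤-of-injection {B = B} {xs} {ys} f f-injective xs! maps-into = injective⇒≤ position-injective
    where
    position : Fin (length xs) → Fin (length ys)
    position i = index (maps-into (∈-lookup i))
    position-injective : Injective _≡_ _≡_ position
    position-injective eq = Unique⇒lookup-injective xs!
      (f-injective (index-injective (setoid B) (maps-into (∈-lookup _)) (maps-into (∈-lookup _)) eq))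

  module _ {P : Pred ℕ p} (P? : Decidable P) where

    filter-upTo-suc : ∀ {n} → ¬ P n → filter P? (upTo (suc n)) ≡ filter P? (upTo n)
    filter-upTo-suc {n} ¬Pn = begin
      filter P? (upTo (suc n))             ≡⟨ cong (filter P?) (upTo-∷ʳ n) ⟨
      filter P? (upTo n ++ [ n ])          ≡⟨ filter-++ P? (upTo n) [ n ] ⟩
      filter P? (upTo n) ++ filter P? [ n ] ≡⟨ cong (filter P? (upTo n) ++_) (filter-reject P? ¬Pn) ⟩
      filter P? (upTo n) ++ []             ≡⟨ ++-identityʳ _ ⟩
      filter P? (upTo n)                   ∎
      where open ≡-Reasoning

  module _ {A : Set a} {P Q R : Pred A ℓ} (P? : Decidable P) (Q? : Decidable Q) (R? : Decidable R)
           (cover : ∀ {x} → P x → Q x ⊎ R x) (disjoint : ∀ {x} → Q x → R x → ⊥) where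

    length-filter-⊎ : ∀ xs → length (filter P? xs) ≡
                      length (filter (λ x → P? x ×-dec Q? x) xs) + length (filter (λ x → P? x ×-dec R? x) xs)
    length-filter-⊎ [] = refl
    length-filter-⊎ (x ∷ xs) with P? x | Q? x | R? x
    ... | no _  | _     | _     = length-filter-⊎ xs
    ... | yes _ | yes q | yes r = contradiction r (disjoint q)
    ... | yes _ | yes _ | no _  = cong suc (length-filter-⊎ xs)
    ... | yes _ | no _  | yes _ = trans (cong suc (length-filter-⊎ xs)) (sym (+-suc _ _))
    ... | yes p | no ¬q | no ¬r with cover p
    ...   | inj₁ q = contradiction q ¬q
    ...   | inj₂ r = contradiction r ¬r


module Liouville where

  open import Defs using (Ωf; Ω; liouville)
  open import Data.Nat.Base
  open import Data.Nat.Properties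
  open import Data.Nat.Divisibility using (divides; _∣?_)
  open import Data.Nat.Primality
    using (_Rough_; 2-rough; rough⇒≤; ∤⇒rough-suc; rough∧∣⇒rough; rough∧∣⇒prime)
  open import Data.Nat.Primality.Factorisation
  open import Data.Nat.ListAction.Properties using (product-++)
  open import Data.Integer.Base as ℤ using (1ℤ; -1ℤ)
  import Data.Integer.Properties as ℤ
  open import Data.List.Base using (length; _∷_; _++_)
  open import Data.List.Properties using (length-++)
  open import Data.List.Relation.Unary.All using (_∷_)
  import Data.List.Relation.Unary.All.Properties as All
  open import Data.List.Relation.Binary.Permutation.Propositional.Properties using (↭-length)
  open import Data.Product.Base using (Σ-syntax; _,_)
  open import Data.Sum.Base using (_⊎_; inj₁; inj₂)
  open import Relation.Nullary.Decidable.Core using (yes; no)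
  open import Relation.Nullary.Negation using (contradiction)
  open import Relation.Binary.PropositionalEquality

  open PrimeFactorisation

  Ωf-1 : ∀ f d → Ωf f d 1 ≡ 0
  Ωf-1 zero    d = refl
  Ωf-1 (suc f) d = refl

  -- The fuel invariant n < f + d survives both steps of the trial division:
  -- incrementing d, and replacing n by its proper divisor n / d.
  Ωf-factorisation : ∀ f d n .{{_ : NonZero n}} → 2 ≤ d → d Rough n → n < f + d →
                     Σ[ F ∈ PrimeFactorisation n ] length (factors F) ≡ Ωf f d n
  Ωf-factorisation f       d 1        _   _     _     = primeFactorisation[1] , sym (Ωf-1 f d)
  Ωf-factorisation zero    d n@(2+ _) _   rough n<d   = contradiction (rough⇒≤ rough) (<⇒≱ n<d)
  Ωf-factorisation (suc f) d n@(2+ _) 2≤d rough n<1+f+d with d ∣? n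
  ... | no d∤n = Ωf-factorisation f (suc d) n (m≤n⇒m≤1+n 2≤d) (∤⇒rough-suc d∤n rough)
                   (subst (n <_) (sym (+-suc f d)) n<1+f+d)
  ... | yes d∣n@(divides k n≡k*d) =
    let F , |F|≡Ωf = Ωf-factorisation f d k 2≤d (rough∧∣⇒rough rough (divides d n≡d*k))
                                      (<-≤-trans k<n (s≤s⁻¹ n<1+f+d))
    in  record
          { factors = d ∷ factors F
          ; isFactorisation = trans n≡d*k (cong (d *_) (isFactorisation F))
          ; factorsPrime = rough∧∣⇒prime {{n>1⇒nonTrivial 2≤d}} rough d∣n ∷ factorsPrime F
          }
        , cong suc |F|≡Ωf
    where
    instance
      k≢0 : NonZero k
      k≢0 = m*n≢0⇒m≢0 k {d} {{subst NonZero n≡k*d nonZero}}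
    n≡d*k : n ≡ d * k
    n≡d*k = trans n≡k*d (*-comm k d)
    k<n : k < n
    k<n = subst (k <_) (sym n≡k*d) (m<m*n k d 2≤d)

  Ω≡length-factors : ∀ {n} .{{_ : NonZero n}} (F : PrimeFactorisation n) → Ω n ≡ length (factors F)
  Ω≡length-factors {n} F
    with F′ , |F′|≡Ω ← Ωf-factorisation (n + n) 2 n ≤-refl 2-rough
                                         (≤-<-trans (m≤m+n n n) (m<m+n (n + n) z<s))
    = trans (sym |F′|≡Ω) (↭-length (factorisationUnique F′ F))

  _*ᶠ_ : ∀ {m n} → PrimeFactorisation m → PrimeFactorisation n → PrimeFactorisation (m * n)
  F *ᶠ G = record
    { factors = factors F ++ factors G
    ; isFactorisation = trans (cong₂ _*_ (isFactorisation F) (isFactorisation G))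
                              (sym (product-++ (factors F) (factors G)))
    ; factorsPrime = All.++⁺ (factorsPrime F) (factorsPrime G)
    }

  Ω-* : ∀ m n .{{_ : NonZero m}} .{{_ : NonZero n}} → Ω (m * n) ≡ Ω m + Ω n
  Ω-* m n = begin
    Ω (m * n)                          ≡⟨ Ω≡length-factors {{m*n≢0 m n}} (F *ᶠ G) ⟩
    length (factors F ++ factors G)    ≡⟨ length-++ (factors F) ⟩
    length (factors F) + length (factors G) ≡⟨ cong₂ _+_ (Ω≡length-factors F) (Ω≡length-factors G) ⟨
    Ω m + Ω n                          ∎
    where
    open ≡-Reasoning
    F : PrimeFactorisation m
    F = factorise m
    G : PrimeFactorisation n
    G = factorise n

  liouville-* : ∀ m n .{{_ : NonZero m}} .{{_ : NonZero n}} → liouville (m * n) ≡ liouville m ℤ.* liouville n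
  liouville-* m n = trans (cong (-1ℤ ℤ.^_) (Ω-* m n)) (ℤ.^-distribˡ-+-* -1ℤ (Ω m) (Ω n))

  -1^k≡±1 : ∀ k → -1ℤ ℤ.^ k ≡ 1ℤ ⊎ -1ℤ ℤ.^ k ≡ -1ℤ
  -1^k≡±1 zero    = inj₁ refl
  -1^k≡±1 (suc k) with -1^k≡±1 k
  ... | inj₁ eq = inj₂ (cong (-1ℤ ℤ.*_) eq)
  ... | inj₂ eq = inj₁ (cong (-1ℤ ℤ.*_) eq)

  liouville≡±1 : ∀ n → liouville n ≡ 1ℤ ⊎ liouville n ≡ -1ℤ
  liouville≡±1 n = -1^k≡±1 (Ω n)

  liouville-nonZero : ∀ n → ℤ.NonZero (liouville n)
  liouville-nonZero n with liouville n | liouville≡±1 n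
  ... | _ | inj₁ refl = _
  ... | _ | inj₂ refl = _

  liouville-2* : ∀ n .{{_ : NonZero n}} → liouville (2 * n) ≡ ℤ.- liouville n
  liouville-2* n = trans (liouville-* 2 n) (ℤ.-1*i≡-i (liouville n))


module Periodicity where

  open import Defs using (liouville)
  open Liouville using (liouville-*; liouville-nonZero)
  open import Data.Nat.Base as ℕ
    using (ℕ; NonZero; NonTrivial; _≤_; _<_; >-nonZero; >-nonZero⁻¹; nonTrivial⇒nonZero; nonTrivial⇒≢1)
  import Data.Nat.Properties as ℕ
  open import Data.Nat.Coprimality using (Coprime; coprime-Bézout)
  open import Data.Nat.GCD using (module Bézout)
  import Data.Nat.Divisibility as ℕ
  open import Data.Integer.Base using (ℤ; +_; -_; _+_; _-_; _*_; 1ℤ; ∣_∣)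
  open import Data.Integer.Properties using (pos-*; pos-+; *-assoc; *-cancelˡ-≡; neg-involutive; +-identityˡ)
  open import Data.Integer.DivMod using (_%ℕ_; _/ℕ_; a≡a%ℕn+[a/ℕn]*n; n%ℕd<d)
  import Data.Integer.Divisibility as Unsigned
  open import Data.Integer.Divisibility.Signed
  open import Data.Integer.Tactic.RingSolver using (solve-∀)
  open import Data.Product.Base using (∃-syntax; _×_; _,_)
  open import Relation.Binary.PropositionalEquality
  open ≡-Reasoning

  pos-1+m*n≡o*p : ∀ m n o p → 1 ℕ.+ m ℕ.* n ≡ o ℕ.* p → 1ℤ + + m * + n ≡ + o * + p
  pos-1+m*n≡o*p m n o p eq = begin
    1ℤ + + m * + n     ≡⟨ cong (λ t → 1ℤ + t) (pos-* m n) ⟨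
    1ℤ + + (m ℕ.* n)   ≡⟨ pos-+ 1 (m ℕ.* n) ⟨
    + (1 ℕ.+ m ℕ.* n)  ≡⟨ cong +_ eq ⟩
    + (o ℕ.* p)        ≡⟨ pos-* o p ⟩
    + o * + p          ∎

  inverse-mod : ∀ {n q} → Coprime n q → ∃[ x ] ∃[ y ] x * + n ≡ 1ℤ + y * + q
  inverse-mod {n} {q} n⊥q with coprime-Bézout n⊥q
  ... | Bézout.+- x y 1+yq≡xn = + x , + y , sym (pos-1+m*n≡o*p y q x n 1+yq≡xn)
  ... | Bézout.-+ x y 1+xn≡yq = - + x , - + y , (begin
    - + x * + n               ≡⟨ negate (+ x) (+ n) ⟩
    1ℤ - (1ℤ + + x * + n)     ≡⟨ cong (λ t → 1ℤ - t) (pos-1+m*n≡o*p x n y q 1+xn≡yq) ⟩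
    1ℤ - + y * + q            ≡⟨ negate′ (+ y) (+ q) ⟩
    1ℤ + - + y * + q          ∎)
    where
    negate : ∀ x n → - x * n ≡ 1ℤ - (1ℤ + x * n)
    negate = solve-∀
    negate′ : ∀ y q → 1ℤ - y * q ≡ 1ℤ + - y * q
    negate′ = solve-∀

  linear-congruence : ∀ {q n} .{{_ : NonTrivial q}} (a : ℤ) → Coprime ∣ a ∣ q → Coprime n q →
                      ∃[ m ] 1 ≤ m × m < q × + q ∣ + m * + n - a
  linear-congruence {q} {n} a a⊥q n⊥q with x , y , xn≡1+yq ← inverse-mod n⊥q =
    m , m≥1 , n%ℕd<d (a * x) q , q∣mn-a
    where
    instance
      q≢0 : NonZero q
      q≢0 = nonTrivial⇒nonZero q
    m : ℕ
    m = (a * x) %ℕ q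
    k : ℤ
    k = (a * x) /ℕ q
    q∣mn-a : + q ∣ + m * + n - a
    q∣mn-a = divides (a * y - k * + n) (begin
      + m * + n - a                               ≡⟨ add-and-subtract (+ m) k (+ n) (+ q) a ⟩
      (+ m + k * + q) * + n - k * + q * + n - a   ≡⟨ cong (λ t → t * + n - k * + q * + n - a) ax≡m+kq ⟨
      a * x * + n - k * + q * + n - a             ≡⟨ cong (λ t → t - k * + q * + n - a) axn≡a[1+yq] ⟩
      a * (1ℤ + y * + q) - k * + q * + n - a      ≡⟨ collect a y k (+ n) (+ q) ⟩
      (a * y - k * + n) * + q                     ∎)
      where
      ax≡m+kq : a * x ≡ + m + k * + q
      ax≡m+kq = a≡a%ℕn+[a/ℕn]*n (a * x) q
      axn≡a[1+yq] : a * x * + n ≡ a * (1ℤ + y * + q)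
      axn≡a[1+yq] = trans (*-assoc a x (+ n)) (cong (a *_) xn≡1+yq)
      add-and-subtract : ∀ m k n q a → m * n - a ≡ (m + k * q) * n - k * q * n - a
      add-and-subtract = solve-∀
      collect : ∀ a y k n q → a * (1ℤ + y * q) - k * q * n - a ≡ (a * y - k * n) * q
      collect = solve-∀
    q∣a : m ≡ 0 → + q ∣ a
    q∣a m≡0 = subst (+ q ∣_) (neg-involutive a)
      (∣m⇒∣-m (subst (+ q ∣_) (+-identityˡ (- a)) (subst (λ t → + q ∣ + t * + n - a) m≡0 q∣mn-a)))
    m≥1 : 1 ≤ m
    m≥1 = ℕ.n≢0⇒n>0 λ m≡0 → nonTrivial⇒≢1 (a⊥q (∣⇒∣ᵤ (q∣a m≡0) , ℕ.∣-refl))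

  ∣m*n-a⇒∣m*[n+q]-a : ∀ {q} a m n → + q ∣ + m * + n - a → + q ∣ + m * + (n ℕ.+ q) - a
  ∣m*n-a⇒∣m*[n+q]-a {q} a m n q∣mn-a = subst (+ q ∣_) (sym (begin
    + m * + (n ℕ.+ q) - a          ≡⟨ cong (λ t → + m * t - a) (pos-+ n q) ⟩
    + m * (+ n + + q) - a          ≡⟨ distrib (+ m) (+ n) (+ q) a ⟩
    (+ m * + n - a) + + m * + q    ∎))
    (∣m∣n⇒∣m+n q∣mn-a (∣n⇒∣m*n (+ m) ∣-refl))
    where
    distrib : ∀ m n q a → m * (n + q) - a ≡ (m * n - a) + m * q
    distrib = solve-∀

  liouville-periodic : ∀ {q N κ} .{{_ : NonTrivial q}} (a : ℤ) → Coprime ∣ a ∣ q →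
                       (∀ n → 1 ≤ n → n ≤ N → + q Unsigned.∣ + n - a → liouville n ≡ κ) →
                       ∀ n → 1 ≤ n → (n ℕ.+ q) ℕ.* q ≤ N → Coprime n q →
                       liouville (n ℕ.+ q) ≡ liouville n
  liouville-periodic {q} {N} {κ} a a⊥q constant n n≥1 bound n⊥q =
    from-multiplier (linear-congruence a a⊥q n⊥q)
    where
    instance
      n≢0 : NonZero n
      n≢0 = >-nonZero n≥1
      n+q≢0 : NonZero (n ℕ.+ q)
      n+q≢0 = >-nonZero (ℕ.≤-trans n≥1 (ℕ.m≤m+n n q))
    from-multiplier : ∃[ m ] 1 ≤ m × m < q × + q ∣ + m * + n - a → liouville (n ℕ.+ q) ≡ liouville n
    from-multiplier (m , m≥1 , m<q , q∣mn-a) = *-cancelˡ-≡ (liouville m) _ _ {{liouville-nonZero m}} (begin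
      liouville m * liouville (n ℕ.+ q)  ≡⟨ liouville-* m (n ℕ.+ q) ⟨
      liouville (m ℕ.* (n ℕ.+ q))        ≡⟨ constant-at (n ℕ.+ q) m[n+q]≤N q∣m[n+q]-a ⟩
      κ                                  ≡⟨ constant-at n mn≤N q∣mn-a ⟨
      liouville (m ℕ.* n)                ≡⟨ liouville-* m n ⟩
      liouville m * liouville n          ∎)
      where
      q∣m[n+q]-a : + q ∣ + m * + (n ℕ.+ q) - a
      q∣m[n+q]-a = ∣m*n-a⇒∣m*[n+q]-a a m n q∣mn-a
      instance
        m≢0 : NonZero m
        m≢0 = >-nonZero m≥1
      constant-at : ∀ k .{{_ : NonZero k}} → m ℕ.* k ≤ N → + q ∣ + m * + k - a → liouville (m ℕ.* k) ≡ κ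
      constant-at k mk≤N q∣mk-a = constant (m ℕ.* k) (>-nonZero⁻¹ (m ℕ.* k) {{ℕ.m*n≢0 m k}}) mk≤N
        (∣⇒∣ᵤ (subst (λ t → + q ∣ t - a) (sym (pos-* m k)) q∣mk-a))
      m[n+q]≤N : m ℕ.* (n ℕ.+ q) ≤ N
      m[n+q]≤N = ℕ.≤-trans (ℕ.*-monoˡ-≤ (n ℕ.+ q) (ℕ.<⇒≤ m<q))
                           (ℕ.≤-trans (ℕ.≤-reflexive (ℕ.*-comm q (n ℕ.+ q))) bound)
      mn≤N : m ℕ.* n ≤ N
      mn≤N = ℕ.≤-trans (ℕ.*-monoʳ-≤ m (ℕ.m≤m+n n q)) m[n+q]≤N


module Balance where

  open import Defs using (liouville; countλ; totient)
  open Liouville using (liouville≡±1; liouville-2*)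
  open ListCounting using (length-≤-of-injection; filter-upTo-suc; length-filter-⊎)
  open import Data.Nat.Base using (ℕ; s≤s; _+_; _*_; _∸_; _≤_; _<_; >-nonZero; nonTrivial⇒≢1)
  open import Data.Nat.Properties
  open import Data.Nat.Divisibility using (_∣_; ∣-refl; m∣m*n; ∣m+n∣m⇒∣n)
  open import Data.Nat.Coprimality using (Coprime; coprime?; prime⇒coprime)
  import Data.Nat.Coprimality as Coprime
  open import Data.Nat.Primality using (Prime; prime⇒nonTrivial; prime⇒irreducible)
  open import Data.Integer.Base as ℤ using (1ℤ; -1ℤ)
  import Data.Integer.Properties as ℤ
  open import Data.List.Base using (filter; upTo; length)
  open import Data.List.Membership.Propositional using (_∈_)
  open import Data.List.Membership.Propositional.Properties using (∈-filter⁺; ∈-filter⁻; ∈-upTo⁺; ∈-upTo⁻)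
  open import Data.List.Relation.Unary.Unique.Propositional.Properties using (filter⁺; upTo⁺)
  open import Data.Product.Base using (_×_; _,_)
  open import Data.Sum.Base using (inj₁; inj₂; swap)
  open import Function.Definitions using (Injective)
  open import Relation.Nullary.Decidable.Core using (yes; no; _×-dec_)
  open import Relation.Nullary.Negation.Core using (¬_; contradiction)
  open import Relation.Unary using (Decidable)
  open import Relation.Binary.PropositionalEquality

  doubleMod : ℕ → ℕ → ℕ
  doubleMod q x with 2 * x <? q
  ... | yes _ = 2 * x
  ... | no  _ = 2 * x ∸ q

  coprime-below : ∀ {q x} → Prime q → 1 ≤ x → x < q → Coprime x q
  coprime-below q-prime 1≤x x<q = Coprime.sym (prime⇒coprime q-prime {{>-nonZero 1≤x}} x<q)

  prime≥3⇒odd : ∀ {q} → Prime q → 3 ≤ q → ¬ 2 ∣ q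
  prime≥3⇒odd q-prime 3≤q 2∣q with prime⇒irreducible q-prime 2∣q
  ... | inj₁ ()
  ... | inj₂ refl = contradiction 3≤q (λ { (s≤s (s≤s ())) })

  module _ {q : ℕ} (q-odd : ¬ 2 ∣ q) where

    2*x∸q≢2*y : ∀ {x y} → q ≤ 2 * x → 2 * x ∸ q ≢ 2 * y
    2*x∸q≢2*y {x} {y} q≤2x eq = q-odd (∣m+n∣m⇒∣n 2∣2y+q (m∣m*n y))
      where
      2∣2y+q : 2 ∣ 2 * y + q
      2∣2y+q = subst (2 ∣_) (trans (sym (m∸n+n≡m q≤2x)) (cong (_+ q) eq)) (m∣m*n x)

    doubleMod-injective : Injective _≡_ _≡_ (doubleMod q)
    doubleMod-injective {x} {y} eq with 2 * x <? q | 2 * y <? q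
    ... | yes _    | yes _    = *-cancelˡ-≡ x y 2 eq
    ... | no 2x≮q | no 2y≮q = *-cancelˡ-≡ x y 2 (∸-cancelʳ-≡ (≮⇒≥ 2x≮q) (≮⇒≥ 2y≮q) eq)
    ... | yes _    | no 2y≮q = contradiction (sym eq) (2*x∸q≢2*y {y} {x} (≮⇒≥ 2y≮q))
    ... | no 2x≮q | yes _    = contradiction eq (2*x∸q≢2*y {x} {y} (≮⇒≥ 2x≮q))

    wrap-range : ∀ {x} → x < q → q ≤ 2 * x → 1 ≤ 2 * x ∸ q × 2 * x ∸ q < q
    wrap-range {x} x<q q≤2x = m<n⇒0<n∸m q<2x , +-cancelʳ-< q (2 * x ∸ q) q (begin-strict
      2 * x ∸ q + q  ≡⟨ m∸n+n≡m q≤2x ⟩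
      2 * x          <⟨ *-monoʳ-< 2 x<q ⟩
      2 * q          ≡⟨ cong (q +_) (+-identityʳ q) ⟩
      q + q          ∎)
      where
      open ≤-Reasoning
      q<2x : q < 2 * x
      q<2x = ≤∧≢⇒< q≤2x (λ q≡2x → q-odd (subst (2 ∣_) (sym q≡2x) (m∣m*n x)))

    doubleMod-range : ∀ {x} → 1 ≤ x → x < q → 1 ≤ doubleMod q x × doubleMod q x < q
    doubleMod-range {x} 1≤x x<q with 2 * x <? q
    ... | yes 2x<q = ≤-trans 1≤x (m≤m+n x (x + 0)) , 2x<q
    ... | no 2x≮q  = wrap-range x<q (≮⇒≥ 2x≮q)

  module _ {q : ℕ} (q-prime : Prime q) (q-odd : ¬ 2 ∣ q)
           (periodic : ∀ n → 1 ≤ n → n < q → liouville (n + q) ≡ liouville n) where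

    liouville-doubleMod : ∀ {x} → 1 ≤ x → x < q → liouville (doubleMod q x) ≡ ℤ.- liouville x
    liouville-doubleMod {x} 1≤x x<q with 2 * x <? q
    ... | yes _   = liouville-2* x {{>-nonZero 1≤x}}
    ... | no 2x≮q with 1≤y , y<q ← wrap-range q-odd x<q (≮⇒≥ 2x≮q) = begin
      liouville (2 * x ∸ q)      ≡⟨ periodic (2 * x ∸ q) 1≤y y<q ⟨
      liouville (2 * x ∸ q + q)  ≡⟨ cong liouville (m∸n+n≡m (≮⇒≥ 2x≮q)) ⟩
      liouville (2 * x)          ≡⟨ liouville-2* x {{>-nonZero 1≤x}} ⟩
      ℤ.- liouville x            ∎
      where open ≡-Reasoning

    private
      unit? : Decidable (λ n → 1 ≤ n × Coprime n q)
      unit? n = (1 ≤? n) ×-dec coprime? n q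

      liouville≡? : ∀ s → Decidable (λ n → liouville n ≡ s)
      liouville≡? s n = liouville n ℤ.≟ s

      class? : ∀ s → Decidable (λ n → (1 ≤ n × Coprime n q) × liouville n ≡ s)
      class? s n = unit? n ×-dec liouville≡? s n

    countλ-≤ : ∀ s → countλ q s ≤ countλ q (ℤ.- s)
    countλ-≤ s = length-≤-of-injection (doubleMod q) (doubleMod-injective q-odd)
                                       (filter⁺ (class? s) (upTo⁺ q)) maps-into
      where
      maps-into : ∀ {x} → x ∈ filter (class? s) (upTo q) → doubleMod q x ∈ filter (class? (ℤ.- s)) (upTo q)
      maps-into x∈class =
        let x∈upTo , (1≤x , _) , λx≡s = ∈-filter⁻ (class? s) x∈class
            x<q = ∈-upTo⁻ x∈upTo
            1≤y , y<q = doubleMod-range q-odd 1≤x x<q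
        in  ∈-filter⁺ (class? (ℤ.- s)) (∈-upTo⁺ y<q)
              ((1≤y , coprime-below q-prime 1≤y y<q) , trans (liouville-doubleMod 1≤x x<q) (cong ℤ.-_ λx≡s))

    totient≡countλ+countλ : totient q ≡ countλ q -1ℤ + countλ q 1ℤ
    totient≡countλ+countλ = trans (cong length (filter-upTo-suc unit? q-not-unit))
      (length-filter-⊎ unit? (liouville≡? -1ℤ) (liouville≡? 1ℤ)
        (λ {n} _ → swap (liouville≡±1 n)) (λ λn≡-1 λn≡1 → -1≢1 (trans (sym λn≡-1) λn≡1))
        (upTo q))
      where
      q-not-unit : ¬ (1 ≤ q × Coprime q q)
      q-not-unit (_ , q⊥q) = nonTrivial⇒≢1 {{prime⇒nonTrivial q-prime}} (q⊥q (∣-refl , ∣-refl))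
      -1≢1 : -1ℤ ≢ 1ℤ
      -1≢1 ()

    liouville-balanced : 2 * countλ q -1ℤ ≡ totient q × 2 * countλ q 1ℤ ≡ totient q
    liouville-balanced = (begin
      2 * c₋    ≡⟨ cong (c₋ +_) (+-identityʳ c₋) ⟩
      c₋ + c₋   ≡⟨ cong (c₋ +_) c₋≡c₊ ⟩
      c₋ + c₊   ≡⟨ totient≡countλ+countλ ⟨
      totient q ∎) , (begin
      2 * c₊    ≡⟨ cong (c₊ +_) (+-identityʳ c₊) ⟩
      c₊ + c₊   ≡⟨ cong (_+ c₊) c₋≡c₊ ⟨
      c₋ + c₊   ≡⟨ totient≡countλ+countλ ⟨
      totient q ∎)
      where
      open ≡-Reasoning
      c₋ c₊ : ℕ
      c₋ = countλ q -1ℤ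
      c₊ = countλ q 1ℤ
      c₋≡c₊ : c₋ ≡ c₊
      c₋≡c₊ = ≤-antisym (countλ-≤ -1ℤ) (countλ-≤ 1ℤ)


module Bound where

  open import Data.Nat.Base
  open import Data.Nat.Properties
  open import Relation.Binary.PropositionalEquality

  ^-distribʳ-* : ∀ m n k → (m * n) ^ k ≡ m ^ k * n ^ k
  ^-distribʳ-* m n zero    = refl
  ^-distribʳ-* m n (suc k) =
    trans (cong (m * n *_) (^-distribʳ-* m n k)) ([m*n]*[o*p]≡[m*o]*[n*p] m n (m ^ k) (n ^ k))

  2*q²≤N : ∀ u v {q N} .{{_ : NonZero u}} .{{_ : NonZero v}} →
           2 ^ v ≤ q → q ^ (2 * v + u) ≤ N ^ v → 2 * q ^ 2 ≤ N
  2*q²≤N u v {q} {N} 2^v≤q q^[2v+u]≤N^v =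
    ≮⇒≥ λ N<2q² → <⇒≱ (^-monoˡ-< v N<2q²) (≤-trans [2q²]^v≤q^[2v+u] q^[2v+u]≤N^v)
    where
    instance
      q≢0 : NonZero q
      q≢0 = >-nonZero (≤-trans (m^n>0 2 v) 2^v≤q)
    2^v≤q^u : 2 ^ v ≤ q ^ u
    2^v≤q^u = ≤-trans 2^v≤q (≤-trans (≤-reflexive (sym (*-identityʳ q))) (^-monoʳ-≤ q (>-nonZero⁻¹ u)))
    open ≤-Reasoning
    [2q²]^v≤q^[2v+u] : (2 * q ^ 2) ^ v ≤ q ^ (2 * v + u)
    [2q²]^v≤q^[2v+u] = begin
      (2 * q ^ 2) ^ v      ≡⟨ ^-distribʳ-* 2 (q ^ 2) v ⟩
      2 ^ v * (q ^ 2) ^ v  ≡⟨ cong (2 ^ v *_) (^-*-assoc q 2 v) ⟩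
      2 ^ v * q ^ (2 * v)  ≤⟨ *-monoˡ-≤ (q ^ (2 * v)) 2^v≤q^u ⟩
      q ^ u * q ^ (2 * v)  ≡⟨ *-comm (q ^ u) (q ^ (2 * v)) ⟩
      q ^ (2 * v) * q ^ u  ≡⟨ ^-distribˡ-+-* q (2 * v) u ⟨
      q ^ (2 * v + u)      ∎

  [n+q]*q≤2*q² : ∀ {n q} → n < q → (n + q) * q ≤ 2 * q ^ 2
  [n+q]*q≤2*q² {n} {q} n<q = begin
    (n + q) * q      ≤⟨ *-monoˡ-≤ q (+-monoˡ-≤ q (<⇒≤ n<q)) ⟩
    (q + q) * q      ≡⟨ cong (λ t → (q + t) * q) (+-identityʳ q) ⟨
    2 * q * q        ≡⟨ *-assoc 2 q q ⟩
    2 * (q * q)      ≡⟨ cong (λ t → 2 * (q * t)) (*-identityʳ q) ⟨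
    2 * q ^ 2        ∎
    where open ≤-Reasoning

open Periodicity using (liouville-periodic)
open Balance using (coprime-below; prime≥3⇒odd; liouville-balanced)
open Bound using (2*q²≤N; [n+q]*q≤2*q²)

open import Defs
open import Data.Nat using (ℕ; _+_; _*_; _^_; _≤_; _≥_; NonZero)
open import Data.Nat.Primality using (Prime)
open import Data.Nat.Coprimality using (Coprime)
open import Data.Integer using (ℤ; +_; -_; ∣_∣) renaming (_-_ to _-ℤ_)
open import Data.Integer.Divisibility using () renaming (_∣_ to _∣ℤ_)
open import Data.Product using (Σ; _×_)
open import Data.Sum using (_⊎_)
open import Relation.Binary.PropositionalEquality using (_≡_)
open import Data.Nat.Properties using (≤-trans; m≤m+n; m≤n+m)
open import Data.Nat.Base using (NonTrivial)
open import Data.Nat.Divisibility using (_∣_)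
open import Relation.Nullary.Negation using (¬_)
open import Data.Nat.Primality using (prime⇒nonTrivial)
open import Data.Product using (_,_)

lemma7 : (u v : ℕ) → .{{NonZero u}} → .{{NonZero v}} →
         Σ ℕ λ Q → (q : ℕ) → Prime q → q ≥ Q →
         (a : ℤ) → Coprime ∣ a ∣ q →
         (κ : ℤ) → (κ ≡ + 1 ⊎ κ ≡ - (+ 1)) →
         (N : ℕ) → N ^ v ≥ q ^ (2 * v + u) →
         ((n : ℕ) → 1 ≤ n → n ≤ N → (+ q) ∣ℤ ((+ n) -ℤ a) → liouville n ≡ κ) →
         ((n : ℕ) → 1 ≤ n → (n + q) * q ≤ N → Coprime n q →
            liouville (n + q) ≡ liouville n)
         × (2 * countλ q (- (+ 1)) ≡ totient q × 2 * countλ q (+ 1) ≡ totient q)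
-- q ≥ 2 ^ v yields N ≥ 2q², and q ≥ 3 makes q odd.
lemma7 u v = 2 ^ v + 3 , λ q q-prime q≥Q a a⊥q κ _ N q^[2v+u]≤N^v constant →
  let instance q-nonTrivial : NonTrivial q
               q-nonTrivial = prime⇒nonTrivial q-prime
      periodic = liouville-periodic a a⊥q constant
      q-odd : ¬ 2 ∣ q
      q-odd = prime≥3⇒odd q-prime (≤-trans (m≤n+m 3 (2 ^ v)) q≥Q)
      2q²≤N : 2 * q ^ 2 ≤ N
      2q²≤N = 2*q²≤N u v (≤-trans (m≤m+n (2 ^ v) 3) q≥Q) q^[2v+u]≤N^v
  in periodic , liouville-balanced q-prime q-odd λ n 1≤n n<q →
       periodic n 1≤n (≤-trans ([n+q]*q≤2*q² n<q) 2q²≤N) (coprime-below q-prime 1≤n n<q)
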